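{- Any regular tree function $\mathrm{BinTree}(\Gamma) \to \mathrm{BinTree}(\Sigma)$ is definable in the simply typed $\lambda$-calculus: there exist a simple type $A$ and a $\lambda$-term $t : \mathtt{BT}_\Gamma[A] \to \mathtt{BT}_\Sigma$ such that $t\;\overline{T} =_\beta \overline{f(T)}$ for every input tree $T$.
   Context: Binary trees over an alphabet $\Sigma$ are generated by $T,U ::= \langle\rangle \mid a\langle T,U\rangle$ ($a \in \Sigma$), forming $\mathrm{BinTree}(\Sigma)$; one-hole binary trees $\partial\mathrm{BinTree}(\Sigma)$ are generated by $T' ::= \square \mid a\langle T',T\rangle \mid a\langle T,T'\rangle$, and $T'[U]$ denotes substitution of $U$ for the hole. Tree expressions $\mathrm{ExprBT}(\Sigma,V,V')$ and one-hole tree expressions $\mathrm{Expr}\partial\mathrm{BT}(\Sigma,V,V')$ over variable sets $V,V'$ are generated by $E,F ::= \langle\rangle \mid x \mid a\langle E,F\rangle \mid E'[E]$ and $E',F' ::= \square \mid x' \mid a\langle E',E\rangle \mid a\langle E,E'\rangle \mid E'[F']$ ($x\in V$, $x'\in V'$). A register tree transducer (RTT) consists of a finite set of states $Q$ with initial state $q_I$, disjoint finite register sets $R$ (tree-valued) and $R'$ (one-hole-tree-valued), an output function $F : Q \to \mathrm{ExprBT}(\Sigma,R,R')$ and a transition function $\delta : Q\times Q\times\Gamma \to Q \times (R \to \mathrm{ExprBT}(\Sigma,R_{\triangleleft\triangleright},R'_{\triangleleft\triangleright})) \times (R' \to \mathrm{Expr}\partial\mathrm{BT}(\Sigma,R_{\triangleleft\triangleright},R'_{\triangleleft\triangleright}))$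 with $R_{\triangleleft\triangleright} = R\times\{\triangleleft,\triangleright\}$; it processes the input tree bottom-up, starting at each leaf in configuration $(q_I, r\mapsto\langle\rangle, r'\mapsto\square)$, and at a node $a\langle T,U\rangle$ combining the configurations of the left ($\triangleleft$) and right ($\triangleright$) subtrees via $\delta$; the output is $F(q)$ evaluated at the final configuration. A conflict relation is a reflexive symmetric binary relation; an expression is consistent with a conflict relation if each variable occurs at most once in it and it does not contain two distinct variables that are in conflict. A bottom-up ranked tree transducer (BRTT, Alur–D'Antoni) is an RTT with a conflict relation on $R\cup R'$ such that every $F(q)$ and every register update expression in every transition is consistent with it, and such that whenever $x_1,x_2$ are in conflict and, for some $z\in\{\triangleleft,\triangleright\}$, $(x_1,z)$ appears in the update of register $y_1$ and $(x_2,z)$ appears in the update of register $y_2$, then $y_1$ and $y_2$ are in conflict. Regular tree functions are exactly the functions computed by BRTTs. In the simply typed $\lambda$-calculus (single base type $o$), $\mathtt{BT}_\Sigma = (o\to o\to o)^{|\Sigma|} \to o \to o$, and for $\Sigma=\{a_1,\dots,a_n\}$ a tree $T$ is encoded as $\overline{T} = \lambda f_1.\ldots\lambda f_n.\lambda x.\widehat{T}$ with $\widehat{\langle\rangle}=x$ and $\widehat{a_i\langle T,U\rangle} = f_i\,\widehat{T}\,\widehat{U}$. For a type $B$, $\mathtt{BT}_\Gamma[B]$ denotes $\mathtt{BT}_\Gamma$ with $o$ substituted by $B$. -}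

module Defs where

open import Data.Nat using (ℕ; zero; suc; _∸_; _<ᵇ_; _≡ᵇ_; pred)
open import Data.Fin using (Fin; toℕ)
open import Data.Bool using (if_then_else_)
open import Data.List using (List; []; _∷_; _++_; map)
open import Data.List.Membership.Propositional using (_∈_)
open import Data.List.Relation.Unary.Unique.Propositional using (Unique)
open import Data.Product using (Σ; _×_; _,_; proj₁; proj₂)
open import Data.Sum using (_⊎_; inj₁; inj₂)
open import Relation.Binary.PropositionalEquality using (_≡_; _≢_)
open import Relation.Nullary using (¬_)

data BinTree (A : Set) : Set where
  ⟨⟩   : BinTree A
  node : A → BinTree A → BinTree A → BinTree A

data ∂BinTree (A : Set) : Set where
  □     : ∂BinTree A
  nodeL : A → ∂BinTree A → BinTree A → ∂BinTree A
  nodeR : A → BinTree A → ∂BinTree A → ∂BinTree A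

plug : {A : Set} → ∂BinTree A → BinTree A → BinTree A
plug □ U = U
plug (nodeL a T' T) U = node a (plug T' U) T
plug (nodeR a T T') U = node a T (plug T' U)

plug∂ : {A : Set} → ∂BinTree A → ∂BinTree A → ∂BinTree A
plug∂ □ U' = U'
plug∂ (nodeL a T' T) U' = nodeL a (plug∂ T' U') T
plug∂ (nodeR a T T') U' = nodeR a T (plug∂ T' U')

mutual
  data ExprBT (S V V' : Set) : Set where
    ⟨⟩    : ExprBT S V V'
    var   : V → ExprBT S V V'
    node  : S → ExprBT S V V' → ExprBT S V V' → ExprBT S V V'
    plugE : Expr∂BT S V V' → ExprBT S V V' → ExprBT S V V'

  data Expr∂BT (S V V' : Set) : Set where
    □      : Expr∂BT S V V'
    var'   : V' → Expr∂BT S V V'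
    nodeL  : S → Expr∂BT S V V' → ExprBT S V V' → Expr∂BT S V V'
    nodeR  : S → ExprBT S V V' → Expr∂BT S V V' → Expr∂BT S V V'
    plug∂E : Expr∂BT S V V' → Expr∂BT S V V' → Expr∂BT S V V'

module _ {S V V' : Set} (ρ : V → BinTree S) (ρ' : V' → ∂BinTree S) where
  mutual
    evalE : ExprBT S V V' → BinTree S
    evalE ⟨⟩ = ⟨⟩
    evalE (var x) = ρ x
    evalE (node a E F) = node a (evalE E) (evalE F)
    evalE (plugE E' E) = plug (evalE∂ E') (evalE E)

    evalE∂ : Expr∂BT S V V' → ∂BinTree S
    evalE∂ □ = □
    evalE∂ (var' x') = ρ' x'
    evalE∂ (nodeL a E' E) = nodeL a (evalE∂ E') (evalE E)
    evalE∂ (nodeR a E E') = nodeR a (evalE E) (evalE∂ E')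
    evalE∂ (plug∂E E' F') = plug∂ (evalE∂ E') (evalE∂ F')

mutual
  varsE : {S V V' : Set} → ExprBT S V V' → List (V ⊎ V')
  varsE ⟨⟩ = []
  varsE (var x) = inj₁ x ∷ []
  varsE (node a E F) = varsE E ++ varsE F
  varsE (plugE E' E) = varsE∂ E' ++ varsE E

  varsE∂ : {S V V' : Set} → Expr∂BT S V V' → List (V ⊎ V')
  varsE∂ □ = []
  varsE∂ (var' x') = inj₂ x' ∷ []
  varsE∂ (nodeL a E' E) = varsE∂ E' ++ varsE E
  varsE∂ (nodeR a E E') = varsE E ++ varsE∂ E'
  varsE∂ (plug∂E E' F') = varsE∂ E' ++ varsE∂ F'

-- ◁ = left child, ▷ = right child
data Side : Set where
  ◁ ▷ : Side

-- Input alphabet Γ = Fin m, output alphabet Σ = Fin n,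
-- states Q = Fin k, registers R = Fin r, R' = Fin r'.
record RTT (m n : ℕ) : Set where
  field
    k r r' : ℕ
    qI     : Fin k
    F      : Fin k → ExprBT (Fin n) (Fin r) (Fin r')
    δ      : Fin k → Fin k → Fin m →
             Fin k
             × (Fin r  → ExprBT  (Fin n) (Fin r × Side) (Fin r' × Side))
             × (Fin r' → Expr∂BT (Fin n) (Fin r × Side) (Fin r' × Side))

  record Config : Set where
    eta-equality
    constructor conf
    field
      state : Fin k
      val   : Fin r → BinTree (Fin n)
      val'  : Fin r' → ∂BinTree (Fin n)

  joinSides : {X Y : Set} → (X → Y) → (X → Y) → X × Side → Y
  joinSides f g (x , ◁) = f x
  joinSides f g (x , ▷) = g x

  step : Fin m → Config → Config → Config
  step a (conf q₁ ρ₁ ρ₁') (conf q₂ ρ₂ ρ₂') =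
    let d = δ q₁ q₂ a
        ρ  = joinSides ρ₁ ρ₂
        ρ' = joinSides ρ₁' ρ₂'
    in conf (proj₁ d)
            (λ x → evalE ρ ρ' (proj₁ (proj₂ d) x))
            (λ x' → evalE∂ ρ ρ' (proj₂ (proj₂ d) x'))

  run : BinTree (Fin m) → Config
  run ⟨⟩ = conf qI (λ _ → ⟨⟩) (λ _ → □)
  run (node a T U) = step a (run T) (run U)

  output : BinTree (Fin m) → BinTree (Fin n)
  output T = let c = run T in evalE (Config.val c) (Config.val' c) (F (Config.state c))

  sideVar : (Fin r × Side) ⊎ (Fin r' × Side) → (Fin r ⊎ Fin r') × Side
  sideVar (inj₁ (x , z)) = inj₁ x , z
  sideVar (inj₂ (x , z)) = inj₂ x , z

  updVars : Fin k → Fin k → Fin m → Fin r ⊎ Fin r' → List ((Fin r ⊎ Fin r') × Side)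
  updVars q₁ q₂ a (inj₁ y) = map sideVar (varsE (proj₁ (proj₂ (δ q₁ q₂ a)) y))
  updVars q₁ q₂ a (inj₂ y) = map sideVar (varsE∂ (proj₂ (proj₂ (δ q₁ q₂ a)) y))

Consistent : {X : Set} → (X → X → Set) → List X → Set
Consistent {X} C l = Unique l × (∀ {u v : X} → u ∈ l → v ∈ l → u ≢ v → ¬ C u v)

liftSide : {X : Set} → (X → X → Set) → X × Side → X × Side → Set
liftSide C (x , z) (x' , z') = (z ≡ z') × C x x'

record BRTT (m n : ℕ) : Set₁ where
  field
    rtt : RTT m n
  open RTT rtt
  field
    conflict  : Fin r ⊎ Fin r' → Fin r ⊎ Fin r' → Set
    c-refl    : ∀ x → conflict x x
    c-sym     : ∀ x y → conflict x y → conflict y x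
    F-cons    : ∀ q → Consistent conflict (varsE (F q))
    upd-cons  : ∀ q₁ q₂ a y → Consistent (liftSide conflict) (updVars q₁ q₂ a y)
    single-use : ∀ q₁ q₂ a x₁ x₂ (z : Side) y₁ y₂ →
                 conflict x₁ x₂ →
                 (x₁ , z) ∈ updVars q₁ q₂ a y₁ →
                 (x₂ , z) ∈ updVars q₁ q₂ a y₂ →
                 conflict y₁ y₂

Regular : {m n : ℕ} → (BinTree (Fin m) → BinTree (Fin n)) → Set₁
Regular {m} {n} f = Σ (BRTT m n) λ B → ∀ T → RTT.output (BRTT.rtt B) T ≡ f T

infixr 5 _⇒_
data Ty : Set where
  o   : Ty
  _⇒_ : Ty → Ty → Ty

data Term : Set where
  var : ℕ → Term
  lam : Ty → Term → Term
  app : Term → Term → Term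

shift : ℕ → Term → Term
shift c (var i) = if i <ᵇ c then var i else var (suc i)
shift c (lam A t) = lam A (shift (suc c) t)
shift c (app t u) = app (shift c t) (shift c u)

-- subst j s t : replace index j by s in t, lowering indices above j
subst : ℕ → Term → Term → Term
subst j s (var i) = if i <ᵇ j then var i else (if i ≡ᵇ j then s else var (pred i))
subst j s (lam A t) = lam A (subst (suc j) (shift 0 s) t)
subst j s (app t u) = app (subst j s t) (subst j s u)

infix 4 _⟶β_ _=β_
data _⟶β_ : Term → Term → Set where
  β    : ∀ {A t s} → app (lam A t) s ⟶β subst 0 s t
  ξlam : ∀ {A t t'} → t ⟶β t' → lam A t ⟶β lam A t'
  ξl   : ∀ {t t' u} → t ⟶β t' → app t u ⟶β app t' u
  ξr   : ∀ {t u u'} → u ⟶β u' → app t u ⟶β app t u'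

data _=β_ : Term → Term → Set where
  step  : ∀ {t u} → t ⟶β u → t =β u
  refl  : ∀ {t} → t =β t
  sym   : ∀ {t u} → t =β u → u =β t
  trans : ∀ {t u v} → t =β u → u =β v → t =β v

Ctx : Set
Ctx = List Ty

infix 3 _∋_∶_ _⊢_∶_
data _∋_∶_ : Ctx → ℕ → Ty → Set where
  here  : ∀ {Γ A} → (A ∷ Γ) ∋ 0 ∶ A
  there : ∀ {Γ A B i} → Γ ∋ i ∶ A → (B ∷ Γ) ∋ suc i ∶ A

data _⊢_∶_ : Ctx → Term → Ty → Set where
  ⊢var : ∀ {Γ i A} → Γ ∋ i ∶ A → Γ ⊢ var i ∶ A
  ⊢lam : ∀ {Γ A B t} → (A ∷ Γ) ⊢ t ∶ B → Γ ⊢ lam A t ∶ A ⇒ B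
  ⊢app : ∀ {Γ A B t u} → Γ ⊢ t ∶ A ⇒ B → Γ ⊢ u ∶ A → Γ ⊢ app t u ∶ B

arrows : ℕ → Ty → Ty → Ty
arrows zero C B = B
arrows (suc j) C B = C ⇒ arrows j C B

BT[_] : ℕ → Ty → Ty
BT[ n ] B = arrows n (B ⇒ B ⇒ B) (B ⇒ B)

BT : ℕ → Ty
BT n = BT[ n ] o

lams : ℕ → Ty → Term → Term
lams zero C t = t
lams (suc j) C t = lam C (lams j C t)

-- \hat T, under binders f_0 … f_{n-1}, x  (x = index 0, f_i = index n - i)
hat : {n : ℕ} → BinTree (Fin n) → Term
hat ⟨⟩ = var 0
hat {n} (node a T U) = app (app (var (suc (n ∸ suc (toℕ a)))) (hat T)) (hat U)

enc : (n : ℕ) → Ty → BinTree (Fin n) → Term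
enc n B T = lams n (B ⇒ B ⇒ B) (lam B (hat T))

module Submission where

-- A configuration (q, ρ, ρ') of the transducer is encoded in continuation-passing style by a
-- term of type Conf = Kont → … → Kont → Tree (k continuations): it calls the q-th continuation
-- on its registers, the trees as Church-encoded output trees and the one-hole trees as functions
-- Tree → Tree.  The input tree, instantiated at type Conf, is folded with the initial
-- configuration at the leaves and, at a letter a, with a combinator that runs the configuration
-- of the left subtree, then that of the right one, whose continuations finally call the
-- continuation of the state δ(q₁, q₂, a) on the compiled register updates.  Feeding the
-- compiled output expressions as continuations yields the encoding of the output.  The
-- λ-calculus may duplicate terms.
--
-- Almost every β-conversion is an instance of appsF-lamsF-β: applying lamsF j τ b to j closed
-- arguments g yields the parallel substitution psub 0 g b.  Closedness of every combinator comes
-- for free from its typing derivation in the empty context (⊢⇒Closed).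

open import Defs
open import Data.Nat using (ℕ; zero; suc; _+_; _∸_; _<_; _≤_; z≤n; s≤s; z<s; s<s; _<ᵇ_; _≡ᵇ_)
open import Data.Nat.Properties
  using (+-suc; +-assoc; +-identityʳ; +-comm; ≤-refl; <-≤-trans; <⇒≤; +-monoʳ-≤; n≤1+n; m≤m+n; m≤n+m;
         n<1+n; m<n⇒m<1+n; +-monoʳ-<; +-cancelˡ-<; m+n∸m≡n; m∸n≤m; m∸[m∸n]≡n; ∸-monoʳ-<;
         m<1+n⇒m<n∨m≡n; <-cmp; <-irrefl; ≤-pred)
open import Data.Bool using (true; false; if_then_else_)
open import Data.Fin using (Fin; toℕ) renaming (zero to fzero; suc to fsuc)
open import Data.Fin.Properties using (toℕ<n)
open import Data.List using ([]; _∷_; _++_; length)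
open import Data.Product using (Σ; _×_; _,_; proj₁; proj₂)
open import Data.Sum using (inj₁; inj₂)
open import Data.Empty using (⊥-elim)
open import Function using (const)
open import Relation.Binary.Bundles using (Setoid)
open import Relation.Binary.Definitions using (tri<; tri≈; tri>)
import Relation.Binary.Reasoning.Setoid as SetoidReasoning
import Relation.Binary.PropositionalEquality as P
open P using (_≡_; cong; cong₂)

<⇒<ᵇ≡true : ∀ {i d} → i < d → (i <ᵇ d) ≡ true
<⇒<ᵇ≡true {zero} {suc d} _ = P.refl
<⇒<ᵇ≡true {suc i} {suc d} (s≤s p) = <⇒<ᵇ≡true p

≤⇒<ᵇ≡false : ∀ {i d} → d ≤ i → (i <ᵇ d) ≡ false
≤⇒<ᵇ≡false {i} {zero} _ = P.refl
≤⇒<ᵇ≡false {suc i} {suc d} (s≤s p) = ≤⇒<ᵇ≡false p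

≡ᵇ-refl : ∀ i → (i ≡ᵇ i) ≡ true
≡ᵇ-refl zero = P.refl
≡ᵇ-refl (suc i) = ≡ᵇ-refl i

<⇒≡ᵇ≡false : ∀ {i j} → i < j → (j ≡ᵇ i) ≡ false
<⇒≡ᵇ≡false {zero} {suc j} _ = P.refl
<⇒≡ᵇ≡false {suc i} {suc j} (s≤s p) = <⇒≡ᵇ≡false p

data Split (d : ℕ) : ℕ → Set where
  below : ∀ {i} → i < d → Split d i
  above : ∀ x → Split d (d + x)

split : ∀ d i → Split d i
split zero i = above i
split (suc d) zero = below z<s
split (suc d) (suc i) with split d i
... | below p = below (s<s p)
... | above x = above x

app-congˡ : ∀ {t t' u} → t =β t' → app t u =β app t' u
app-congˡ (step s) = step (ξl s)
app-congˡ refl = refl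
app-congˡ (sym p) = sym (app-congˡ p)
app-congˡ (trans p q) = trans (app-congˡ p) (app-congˡ q)

app-congʳ : ∀ {t u u'} → u =β u' → app t u =β app t u'
app-congʳ (step s) = step (ξr s)
app-congʳ refl = refl
app-congʳ (sym p) = sym (app-congʳ p)
app-congʳ (trans p q) = trans (app-congʳ p) (app-congʳ q)

app-cong : ∀ {t t' u u'} → t =β t' → u =β u' → app t u =β app t' u'
app-cong p q = trans (app-congˡ p) (app-congʳ q)

lam-cong : ∀ {A t t'} → t =β t' → lam A t =β lam A t'
lam-cong (step s) = step (ξlam s)
lam-cong refl = refl
lam-cong (sym p) = sym (lam-cong p)
lam-cong (trans p q) = trans (lam-cong p) (lam-cong q)

≡⇒=β : ∀ {t u} → t ≡ u → t =β u
≡⇒=β P.refl = refl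

=β-setoid : Setoid _ _
=β-setoid = record
  { Carrier = Term
  ; _≈_ = _=β_
  ; isEquivalence = record { refl = refl ; sym = sym ; trans = trans }
  }

module =β-Reasoning = SetoidReasoning =β-setoid

Scoped : ℕ → Term → Set
Scoped d (var i) = i < d
Scoped d (lam A t) = Scoped (suc d) t
Scoped d (app t u) = Scoped d t × Scoped d u

Closed : Term → Set
Closed = Scoped 0

ClosedEnv : (ℕ → Term) → Set
ClosedEnv g = ∀ i → Closed (g i)

Scoped-mono : ∀ {d e} t → d ≤ e → Scoped d t → Scoped e t
Scoped-mono (var i) le c = <-≤-trans c le
Scoped-mono (lam A t) le c = Scoped-mono t (s≤s le) c
Scoped-mono (app t u) le (c , c') = Scoped-mono t le c , Scoped-mono u le c'

Closed⇒Scoped : ∀ {d} t → Closed t → Scoped d t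
Closed⇒Scoped t = Scoped-mono t z≤n

∋⇒<length : ∀ {Γ i A} → Γ ∋ i ∶ A → i < length Γ
∋⇒<length here = z<s
∋⇒<length (there p) = s<s (∋⇒<length p)

⊢⇒Scoped : ∀ {Γ t A} → Γ ⊢ t ∶ A → Scoped (length Γ) t
⊢⇒Scoped (⊢var p) = ∋⇒<length p
⊢⇒Scoped (⊢lam d) = ⊢⇒Scoped d
⊢⇒Scoped (⊢app d e) = ⊢⇒Scoped d , ⊢⇒Scoped e

⊢⇒Closed : ∀ {t A} → [] ⊢ t ∶ A → Closed t
⊢⇒Closed = ⊢⇒Scoped

shift-scoped : ∀ {d c} t → Scoped d t → d ≤ c → shift c t ≡ t
shift-scoped (var i) p le rewrite <⇒<ᵇ≡true (<-≤-trans p le) = P.refl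
shift-scoped (lam A t) p le = cong (lam A) (shift-scoped t p (s≤s le))
shift-scoped (app t u) (p , q) le = cong₂ app (shift-scoped t p le) (shift-scoped u q le)

shift-closed : ∀ {c} t → Closed t → shift c t ≡ t
shift-closed t c = shift-scoped t c z≤n

subst-var-< : ∀ {i c} s → i < c → subst c s (var i) ≡ var i
subst-var-< s p rewrite <⇒<ᵇ≡true p = P.refl

subst-var-≡ : ∀ c s → subst c s (var c) ≡ s
subst-var-≡ c s rewrite ≤⇒<ᵇ≡false (≤-refl {c}) | ≡ᵇ-refl c = P.refl

subst-scoped : ∀ {d c} s t → Scoped d t → d ≤ c → subst c s t ≡ t
subst-scoped s (var i) p le = subst-var-< s (<-≤-trans p le)
subst-scoped s (lam A t) p le = cong (lam A) (subst-scoped (shift 0 s) t p (s≤s le))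
subst-scoped s (app t u) (p , q) le = cong₂ app (subst-scoped s t p le) (subst-scoped s u q le)

subst-closed : ∀ {c} s t → Closed t → subst c s t ≡ t
subst-closed s t c = subst-scoped s t c z≤n

Scoped-subst : ∀ {d} s t → Scoped (suc d) t → Closed s → Scoped d (subst d s t)
Scoped-subst {d} s (var i) p cs with m<1+n⇒m<n∨m≡n p
... | inj₁ i<d rewrite subst-var-< s i<d = i<d
... | inj₂ P.refl rewrite subst-var-≡ d s = Closed⇒Scoped s cs
Scoped-subst s (lam A t) p cs rewrite shift-closed {0} s cs = Scoped-subst s t p cs
Scoped-subst s (app t u) (p , q) cs = Scoped-subst s t p cs , Scoped-subst s u q cs

-- psub d g t substitutes g x for the free index d + x of t.  It does not shift g,
-- so it is only meaningful for closed environments.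
psub : ℕ → (ℕ → Term) → Term → Term
psub d g (var i) = if i <ᵇ d then var i else g (i ∸ d)
psub d g (lam A t) = lam A (psub (suc d) g t)
psub d g (app t u) = app (psub d g t) (psub d g u)

psub-var-< : ∀ {d i} g → i < d → psub d g (var i) ≡ var i
psub-var-< g p rewrite <⇒<ᵇ≡true p = P.refl

psub-var-+ : ∀ d x g → psub d g (var (d + x)) ≡ g x
psub-var-+ d x g rewrite ≤⇒<ᵇ≡false (m≤m+n d x) | m+n∸m≡n d x = P.refl

psub-scoped : ∀ {e d} g t → Scoped e t → e ≤ d → psub d g t ≡ t
psub-scoped g (var i) p le = psub-var-< g (<-≤-trans p le)
psub-scoped g (lam A t) p le = cong (lam A) (psub-scoped g t p (s≤s le))
psub-scoped g (app t u) (p , q) le = cong₂ app (psub-scoped g t p le) (psub-scoped g u q le)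

psub-closed : ∀ {d} g t → Closed t → psub d g t ≡ t
psub-closed g t c = psub-scoped g t c z≤n

Scoped-psub : ∀ {d j} g t → Scoped (d + j) t → ClosedEnv g → Scoped d (psub d g t)
Scoped-psub {d} g (var i) p cg with split d i
... | below i<d rewrite psub-var-< g i<d = i<d
... | above x rewrite psub-var-+ d x g = Closed⇒Scoped (g x) (cg x)
Scoped-psub g (lam A t) p cg = Scoped-psub g t p cg
Scoped-psub g (app t u) (p , q) cg = Scoped-psub g t p cg , Scoped-psub g u q cg

psub-subst : ∀ d j g t → Scoped (suc (d + j)) t → Closed (g j) →
             psub d g (subst (d + j) (g j) t) ≡ psub d g t
psub-subst d j g (var i) p c with m<1+n⇒m<n∨m≡n p
... | inj₁ i<d+j rewrite subst-var-< (g j) i<d+j = P.refl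
... | inj₂ P.refl rewrite subst-var-≡ (d + j) (g j) | psub-var-+ d j g = psub-closed g (g j) c
psub-subst d j g (lam A t) p c rewrite shift-closed {0} (g j) c = cong (lam A) (psub-subst (suc d) j g t p c)
psub-subst d j g (app t u) (p , q) c = cong₂ app (psub-subst d j g t p c) (psub-subst d j g u q c)

joinEnv : ℕ → (ℕ → Term) → (ℕ → Term) → ℕ → Term
joinEnv c a b i = if i <ᵇ c then a i else b (i ∸ c)

joinEnv-< : ∀ c a b {i} → i < c → joinEnv c a b i ≡ a i
joinEnv-< c a b p rewrite <⇒<ᵇ≡true p = P.refl

joinEnv-+ : ∀ c a b i → joinEnv c a b (c + i) ≡ b i
joinEnv-+ c a b i rewrite ≤⇒<ᵇ≡false (m≤m+n c i) | m+n∸m≡n c i = P.refl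

joinEnv-at : ∀ c a b → joinEnv c a b c ≡ b 0
joinEnv-at c a b = P.subst (λ i → joinEnv c a b i ≡ b 0) (+-identityʳ c) (joinEnv-+ c a b 0)

joinEnv-at-suc : ∀ c a b → joinEnv c a b (suc c) ≡ b 1
joinEnv-at-suc c a b = P.subst (λ i → joinEnv c a b i ≡ b 1) (+-comm c 1) (joinEnv-+ c a b 1)

args₂ : Term → Term → ℕ → Term
args₂ t u zero = u
args₂ t u (suc _) = t

args₂-closed : ∀ {t u} → Closed t → Closed u → ClosedEnv (args₂ t u)
args₂-closed ct cu zero = cu
args₂-closed ct cu (suc _) = ct

joinEnv-closed : ∀ c a b → ClosedEnv a → ClosedEnv b → ClosedEnv (joinEnv c a b)
joinEnv-closed c a b ca cb i with i <ᵇ c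
... | true = ca i
... | false = cb (i ∸ c)

psub-psub : ∀ d j a g t → ClosedEnv g → psub d a (psub (d + j) g t) ≡ psub d (joinEnv j a g) t
psub-psub d j a g (var i) cg with split d i
... | below i<d
  rewrite psub-var-< g (<-≤-trans i<d (m≤m+n d j)) | psub-var-< a i<d | psub-var-< (joinEnv j a g) i<d = P.refl
... | above x with split j x
...   | below x<j
  rewrite psub-var-< g (+-monoʳ-< d x<j) | psub-var-+ d x a | psub-var-+ d x (joinEnv j a g) = P.sym (joinEnv-< j a g x<j)
...   | above y
  rewrite P.sym (+-assoc d j y) | psub-var-+ (d + j) y g | +-assoc d j y
        | psub-var-+ d (j + y) (joinEnv j a g) | joinEnv-+ j a g y = psub-closed a (g y) (cg y)
psub-psub d j a g (lam A t) cg = cong (lam A) (psub-psub (suc d) j a g t cg)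
psub-psub d j a g (app t u) cg = cong₂ app (psub-psub d j a g t cg) (psub-psub d j a g u cg)

-- In lamsF j τ b the binder of type τ i binds the index i of b; appsF t j g feeds g (j - 1), …, g 0.
lamsF : ℕ → (ℕ → Ty) → Term → Term
lamsF zero τ b = b
lamsF (suc j) τ b = lam (τ j) (lamsF j τ b)

appsF : Term → ℕ → (ℕ → Term) → Term
appsF t zero g = t
appsF t (suc j) g = appsF (app t (g j)) j g

arrowsF : ℕ → (ℕ → Ty) → Ty → Ty
arrowsF zero τ B = B
arrowsF (suc j) τ B = τ j ⇒ arrowsF j τ B

arrowsF-ext : ∀ j τ τ' B → (∀ i → i < j → τ i ≡ τ' i) → arrowsF j τ B ≡ arrowsF j τ' B
arrowsF-ext zero τ τ' B h = P.refl
arrowsF-ext (suc j) τ τ' B h = cong₂ _⇒_ (h j (n<1+n j)) (arrowsF-ext j τ τ' B (λ i p → h i (m<n⇒m<1+n p)))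

appsF-congˡ : ∀ {t t'} j g → t =β t' → appsF t j g =β appsF t' j g
appsF-congˡ zero g p = p
appsF-congˡ (suc j) g p = appsF-congˡ j g (app-congˡ p)

appsF-congʳ : ∀ t j g g' → (∀ i → i < j → g i =β g' i) → appsF t j g =β appsF t j g'
appsF-congʳ t zero g g' h = refl
appsF-congʳ t (suc j) g g' h =
  trans (appsF-congˡ j g (app-congʳ (h j (n<1+n j))))
        (appsF-congʳ (app t (g' j)) j g g' (λ i p → h i (m<n⇒m<1+n p)))

appsF-ext : ∀ t j g g' → (∀ i → i < j → g i ≡ g' i) → appsF t j g ≡ appsF t j g'
appsF-ext t zero g g' h = P.refl
appsF-ext t (suc j) g g' h rewrite h j (n<1+n j) = appsF-ext (app t (g' j)) j g g' (λ i p → h i (m<n⇒m<1+n p))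

appsF-joinEnv : ∀ t j c a b → appsF t (j + c) (joinEnv c a b) ≡ appsF (appsF t j b) c a
appsF-joinEnv t zero c a b = appsF-ext t c (joinEnv c a b) a (λ i → joinEnv-< c a b)
appsF-joinEnv t (suc j) c a b
  rewrite appsF-joinEnv (app t (joinEnv c a b (j + c))) j c a b | +-comm j c | joinEnv-+ c a b j = P.refl

psub-appsF : ∀ d g t j f → psub d g (appsF t j f) ≡ appsF (psub d g t) j (λ i → psub d g (f i))
psub-appsF d g t zero f = P.refl
psub-appsF d g t (suc j) f = psub-appsF d g (app t (f j)) j f

psub-appsF-vars : ∀ d g h → psub d g (appsF (var (d + h)) d var) ≡ appsF (g h) d var
psub-appsF-vars d g h =
  P.trans (psub-appsF d g (var (d + h)) d var)
  (P.trans (cong (λ z → appsF z d (λ i → psub d g (var i))) (psub-var-+ d h g))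
           (appsF-ext (g h) d _ _ (λ i p → psub-var-< g p)))

subst-appsF-closed : ∀ c s t j g → ClosedEnv g → subst c s (appsF t j g) ≡ appsF (subst c s t) j g
subst-appsF-closed c s t zero g cg = P.refl
subst-appsF-closed c s t (suc j) g cg
  rewrite subst-appsF-closed c s (app t (g j)) j g cg =
    cong (λ u → appsF (app (subst c s t) u) j g) (subst-closed s (g j) (cg j))

psub-lamsF : ∀ d g j τ b → psub d g (lamsF j τ b) ≡ lamsF j τ (psub (d + j) g b)
psub-lamsF d g zero τ b rewrite +-identityʳ d = P.refl
psub-lamsF d g (suc j) τ b rewrite psub-lamsF (suc d) g j τ b | +-suc d j = P.refl

subst-lamsF : ∀ c s j τ b → Closed s → subst c s (lamsF j τ b) ≡ lamsF j τ (subst (c + j) s b)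
subst-lamsF c s zero τ b cs rewrite +-identityʳ c = P.refl
subst-lamsF c s (suc j) τ b cs rewrite shift-closed {0} s cs | subst-lamsF (suc c) s j τ b cs | +-suc c j = P.refl

lamsF-cong : ∀ j τ {b b'} → b =β b' → lamsF j τ b =β lamsF j τ b'
lamsF-cong zero τ p = p
lamsF-cong (suc j) τ p = lam-cong (lamsF-cong j τ p)

appsF-lamsF-β : ∀ j τ b g → Scoped j b → ClosedEnv g → appsF (lamsF j τ b) j g =β psub 0 g b
appsF-lamsF-β zero τ b g sb cg = ≡⇒=β (P.sym (psub-scoped g b sb z≤n))
appsF-lamsF-β (suc j) τ b g sb cg = begin
  appsF (app (lamsF (suc j) τ b) (g j)) j g  ≈⟨ appsF-congˡ j g (step β) ⟩
  appsF (subst 0 (g j) (lamsF j τ b)) j g    ≡⟨ cong (λ t → appsF t j g) (subst-lamsF 0 (g j) j τ b (cg j)) ⟩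
  appsF (lamsF j τ (subst j (g j) b)) j g    ≈⟨ appsF-lamsF-β j τ _ g (Scoped-subst (g j) b sb (cg j)) cg ⟩
  psub 0 g (subst j (g j) b)                 ≡⟨ psub-subst 0 j g b sb (cg j) ⟩
  psub 0 g b                                 ∎
  where open =β-Reasoning

appsF-psub-lamsF-β : ∀ j τ e b g a → Scoped (j + e) b → ClosedEnv g → ClosedEnv a →
                     appsF (psub 0 g (lamsF j τ b)) j a =β psub 0 (joinEnv j a g) b
appsF-psub-lamsF-β j τ e b g a sb cg ca = begin
  appsF (psub 0 g (lamsF j τ b)) j a  ≡⟨ cong (λ t → appsF t j a) (psub-lamsF 0 g j τ b) ⟩
  appsF (lamsF j τ (psub j g b)) j a  ≈⟨ appsF-lamsF-β j τ _ a (Scoped-psub g b sb cg) ca ⟩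
  psub 0 a (psub j g b)               ≡⟨ psub-psub 0 j a g b cg ⟩
  psub 0 (joinEnv j a g) b            ∎
  where open =β-Reasoning

raise : ℕ → ℕ → Term → Term
raise d j (var i) = if i <ᵇ d + j then var i else var (i + j)
raise d j (lam A t) = lam A (raise (suc d) j t)
raise d j (app t u) = app (raise d j t) (raise d j u)

raise-zero : ∀ d b → raise d 0 b ≡ b
raise-zero d (var i) with i <ᵇ d + 0
... | true = P.refl
... | false = cong var (+-identityʳ i)
raise-zero d (lam A t) = cong (lam A) (raise-zero (suc d) t)
raise-zero d (app t u) = cong₂ app (raise-zero d t) (raise-zero d u)

raise-scoped : ∀ d j b → Scoped (d + j) b → raise d j b ≡ b
raise-scoped d j (var i) c rewrite <⇒<ᵇ≡true c = P.refl
raise-scoped d j (lam A t) c = cong (lam A) (raise-scoped (suc d) j t c)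
raise-scoped d j (app t u) (c , c') = cong₂ app (raise-scoped d j t c) (raise-scoped d j u c')

subst-raise : ∀ d j b → subst (d + j) (var (d + j + j)) (raise d (suc j) b) ≡ raise d j b
subst-raise d j (var i) with <-cmp i (d + j)
... | tri< i<d+j _ _
  rewrite <⇒<ᵇ≡true (<-≤-trans i<d+j (+-monoʳ-≤ d (n≤1+n j)))
        | <⇒<ᵇ≡true i<d+j = P.refl
... | tri≈ _ P.refl _
  rewrite <⇒<ᵇ≡true (+-monoʳ-< d (n<1+n j)) | ≤⇒<ᵇ≡false (≤-refl {d + j}) | ≡ᵇ-refl (d + j) = P.refl
... | tri> _ _ d+j<i
  rewrite ≤⇒<ᵇ≡false (P.subst (_≤ i) (P.sym (+-suc d j)) d+j<i)
        | ≤⇒<ᵇ≡false (<⇒≤ (<-≤-trans d+j<i (m≤m+n i (suc j))))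
        | <⇒≡ᵇ≡false (<-≤-trans d+j<i (m≤m+n i (suc j)))
        | ≤⇒<ᵇ≡false (<⇒≤ d+j<i) | +-suc i j = P.refl
subst-raise d j (lam A t) = cong (lam A) (subst-raise (suc d) j t)
subst-raise d j (app t u) = cong₂ app (subst-raise d j t) (subst-raise d j u)

subst-var-lamsF : ∀ c x j τ b → subst c (var x) (lamsF j τ b) ≡ lamsF j τ (subst (c + j) (var (x + j)) b)
subst-var-lamsF c x zero τ b rewrite +-identityʳ c | +-identityʳ x = P.refl
subst-var-lamsF c x (suc j) τ b rewrite subst-var-lamsF (suc c) (suc x) j τ b | +-suc c j | +-suc x j = P.refl

appsF-lamsF-raise : ∀ j τ b → appsF (lamsF j τ (raise 0 j b)) j var =β b
appsF-lamsF-raise zero τ b = ≡⇒=β (raise-zero 0 b)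
appsF-lamsF-raise (suc j) τ b = begin
  appsF (app (lamsF (suc j) τ (raise 0 (suc j) b)) (var j)) j var
    ≈⟨ appsF-congˡ j var (step β) ⟩
  appsF (subst 0 (var j) (lamsF j τ (raise 0 (suc j) b))) j var
    ≡⟨ cong (λ t → appsF t j var) (subst-var-lamsF 0 j j τ (raise 0 (suc j) b)) ⟩
  appsF (lamsF j τ (subst j (var (j + j)) (raise 0 (suc j) b))) j var
    ≡⟨ cong (λ t → appsF (lamsF j τ t) j var) (subst-raise 0 j b) ⟩
  appsF (lamsF j τ (raise 0 j b)) j var
    ≈⟨ appsF-lamsF-raise j τ b ⟩
  b ∎
  where open =β-Reasoning

appsF-lamsF-vars : ∀ j τ b → Scoped j b → appsF (lamsF j τ b) j var =β b
appsF-lamsF-vars j τ b sb = P.subst (λ t → appsF (lamsF j τ t) j var =β b) (raise-scoped 0 j b sb) (appsF-lamsF-raise j τ b)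

extendF : ℕ → (ℕ → Ty) → Ctx → Ctx
extendF zero τ Γ = Γ
extendF (suc j) τ Γ = extendF j τ (τ j ∷ Γ)

length-extendF : ∀ j τ Γ → length (extendF j τ Γ) ≡ j + length Γ
length-extendF zero τ Γ = P.refl
length-extendF (suc j) τ Γ = P.trans (length-extendF j τ (τ j ∷ Γ)) (+-suc j (length Γ))

⊢⇒Scoped-extendF : ∀ {Γ t A} j τ → extendF j τ Γ ⊢ t ∶ A → Scoped (j + length Γ) t
⊢⇒Scoped-extendF {Γ} {t} j τ d = P.subst (λ e → Scoped e t) (length-extendF j τ Γ) (⊢⇒Scoped d)

⊢⇒Scoped-extendF-[] : ∀ {t A} j τ → extendF j τ [] ⊢ t ∶ A → Scoped j t
⊢⇒Scoped-extendF-[] {t} j τ d = P.subst (λ e → Scoped e t) (+-identityʳ j) (⊢⇒Scoped-extendF j τ d)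

⊢lamsF : ∀ {Γ B b} j τ → extendF j τ Γ ⊢ b ∶ B → Γ ⊢ lamsF j τ b ∶ arrowsF j τ B
⊢lamsF zero τ d = d
⊢lamsF (suc j) τ d = ⊢lam (⊢lamsF j τ d)

⊢appsF : ∀ {Γ B t} j τ g → Γ ⊢ t ∶ arrowsF j τ B → (∀ i → i < j → Γ ⊢ g i ∶ τ i) → Γ ⊢ appsF t j g ∶ B
⊢appsF zero τ g d dg = d
⊢appsF (suc j) τ g d dg = ⊢appsF j τ g (⊢app d (dg j (n<1+n j))) (λ i p → dg i (m<n⇒m<1+n p))

∋-extendF-outer : ∀ {Γ i X} j τ → Γ ∋ i ∶ X → extendF j τ Γ ∋ j + i ∶ X
∋-extendF-outer zero τ p = p
∋-extendF-outer {Γ} {i} {X} (suc j) τ p =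
  P.subst (λ z → extendF j τ (τ j ∷ Γ) ∋ z ∶ X) (+-suc j i) (∋-extendF-outer j τ (there p))

∋-extendF : ∀ {Γ i} j τ → i < j → extendF j τ Γ ∋ i ∶ τ i
∋-extendF {Γ} {i} (suc j) τ p with <-cmp i j
... | tri< i<j _ _ = ∋-extendF j τ i<j
... | tri≈ _ P.refl _ = P.subst (λ z → extendF i τ (τ i ∷ Γ) ∋ z ∶ τ i) (+-identityʳ i) (∋-extendF-outer i τ here)
... | tri> _ _ j<i = ⊥-elim (<-irrefl P.refl (<-≤-trans j<i (≤-pred p)))

∋-extendF-≡ : ∀ {Γ i X} j τ → i < j → τ i ≡ X → extendF j τ Γ ∋ i ∶ X
∋-extendF-≡ j τ p P.refl = ∋-extendF j τ p

weaken∋ : ∀ {Γ Δ i A} → Γ ∋ i ∶ A → (Γ ++ Δ) ∋ i ∶ A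
weaken∋ here = here
weaken∋ (there p) = there (weaken∋ p)

weaken : ∀ {Γ Δ t A} → Γ ⊢ t ∶ A → (Γ ++ Δ) ⊢ t ∶ A
weaken (⊢var p) = ⊢var (weaken∋ p)
weaken (⊢lam d) = ⊢lam (weaken d)
weaken (⊢app d e) = ⊢app (weaken d) (weaken e)

weaken-[] : ∀ {Δ t A} → [] ⊢ t ∶ A → Δ ⊢ t ∶ A
weaken-[] = weaken

-- Beyond the domain of f, fromFin f is padded with the closed term junk.
junk : Term
junk = lam o (var 0)

fromFin : ∀ {j} → (Fin j → Term) → ℕ → Term
fromFin {zero} f i = junk
fromFin {suc j} f zero = f fzero
fromFin {suc j} f (suc i) = fromFin (λ x → f (fsuc x)) i

fromFin-toℕ : ∀ {j} f (x : Fin j) → fromFin f (toℕ x) ≡ f x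
fromFin-toℕ f fzero = P.refl
fromFin-toℕ f (fsuc x) = fromFin-toℕ (λ y → f (fsuc y)) x

fromFin-all : ∀ {j} (Q : Term → Set) f → Q junk → (∀ x → Q (f x)) → ∀ i → Q (fromFin {j} f i)
fromFin-all {zero} Q f qj h i = qj
fromFin-all {suc j} Q f qj h zero = h fzero
fromFin-all {suc j} Q f qj h (suc i) = fromFin-all Q (λ x → f (fsuc x)) qj (λ x → h (fsuc x)) i

fromFin-closed : ∀ {j} f → (∀ x → Closed (f x)) → ClosedEnv (fromFin {j} f)
fromFin-closed f = fromFin-all Closed f z<s

psub-fromFin-closed : ∀ {e j} g f → (∀ x → Scoped e (f x)) → ClosedEnv g → ClosedEnv (λ i → psub 0 g (fromFin {j} f i))
psub-fromFin-closed g f sf cg i =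
  Scoped-psub g (fromFin f i) (fromFin-all (Scoped _) f (Closed⇒Scoped junk z<s) sf i) cg

⊢fromFin : ∀ {Γ X j} f → (∀ x → Γ ⊢ f x ∶ X) → ∀ i → i < j → Γ ⊢ fromFin {j} f i ∶ X
⊢fromFin {j = suc j} f h zero _ = h fzero
⊢fromFin {j = suc j} f h (suc i) (s≤s p) = ⊢fromFin (λ x → f (fsuc x)) (λ x → h (fsuc x)) i p

fromFin-map : ∀ {j} (h : Term → Term) f → h junk ≡ junk → ∀ i → h (fromFin {j} f i) ≡ fromFin (λ x → h (f x)) i
fromFin-map {zero} h f e i = e
fromFin-map {suc j} h f e zero = P.refl
fromFin-map {suc j} h f e (suc i) = fromFin-map h (λ x → f (fsuc x)) e i

fromFin-=β : ∀ {j} f f' → (∀ x → f x =β f' x) → ∀ i → fromFin {j} f i =β fromFin f' i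
fromFin-=β {zero} f f' h i = refl
fromFin-=β {suc j} f f' h zero = h fzero
fromFin-=β {suc j} f f' h (suc i) = fromFin-=β (λ x → f (fsuc x)) (λ x → f' (fsuc x)) (λ x → h (fsuc x)) i

joinEnv-=β : ∀ c a b a' b' → (∀ i → a i =β a' i) → (∀ i → b i =β b' i) → ∀ i → joinEnv c a b i =β joinEnv c a' b' i
joinEnv-=β c a b a' b' ha hb i with i <ᵇ c
... | true = ha i
... | false = hb (i ∸ c)

joinTy : ℕ → Ty → Ty → ℕ → Ty
joinTy c X Y i = if i <ᵇ c then X else Y

joinTy-< : ∀ c X Y {i} → i < c → joinTy c X Y i ≡ X
joinTy-< c X Y p rewrite <⇒<ᵇ≡true p = P.refl

joinTy-≥ : ∀ c X Y {i} → c ≤ i → joinTy c X Y i ≡ Y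
joinTy-≥ c X Y p rewrite ≤⇒<ᵇ≡false p = P.refl

⊢joinEnv : ∀ {Γ} c e X Y a b → (∀ i → i < c → Γ ⊢ a i ∶ X) → (∀ i → i < e → Γ ⊢ b i ∶ Y) →
         ∀ i → i < c + e → Γ ⊢ joinEnv c a b i ∶ joinTy c X Y i
⊢joinEnv c e X Y a b ha hb i p with split c i
... | below i<c rewrite joinEnv-< c a b i<c | joinTy-< c X Y i<c = ha i i<c
... | above x rewrite joinEnv-+ c a b x | joinTy-≥ c X Y (m≤m+n c x) = hb x (+-cancelˡ-< c x e p)

encFamily : Ty → Ty → ℕ → Ty
encFamily A C zero = A
encFamily A C (suc _) = C

lams-lam≡lamsF : ∀ j C A b → lams j C (lam A b) ≡ lamsF (suc j) (encFamily A C) b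
lams-lam≡lamsF zero C A b = P.refl
lams-lam≡lamsF (suc j) C A b = cong (lam C) (lams-lam≡lamsF j C A b)

arrows≡arrowsF : ∀ j C A B → arrows j C (A ⇒ B) ≡ arrowsF (suc j) (encFamily A C) B
arrows≡arrowsF zero C A B = P.refl
arrows≡arrowsF (suc j) C A B = cong (C ⇒_) (arrows≡arrowsF j C A B)

label< : ∀ {n} (a : Fin n) → suc (n ∸ suc (toℕ a)) < suc n
label< {suc n} a = s<s (s<s (m∸n≤m n (toℕ a)))

label-inverse : ∀ {m} (a : Fin m) → m ∸ suc (m ∸ suc (toℕ a)) ≡ toℕ a
label-inverse {suc m} a = m∸[m∸n]≡n (≤-pred (toℕ<n a))

⊢hat : ∀ {n Γ} (T : BinTree (Fin n)) → extendF (suc n) (encFamily o (o ⇒ o ⇒ o)) Γ ⊢ hat T ∶ o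
⊢hat {n} ⟨⟩ = ⊢var (∋-extendF (suc n) _ z<s)
⊢hat {n} (node a T U) = ⊢app (⊢app (⊢var (∋-extendF (suc n) _ (label< a))) (⊢hat T)) (⊢hat U)

Scoped-hat : ∀ {n} (T : BinTree (Fin n)) → Scoped (suc n) (hat T)
Scoped-hat T = ⊢⇒Scoped-extendF-[] _ _ (⊢hat T)

module OutputTrees (n : ℕ) where

  τo : ℕ → Ty
  τo = encFamily o (o ⇒ o ⇒ o)

  Tree : Ty
  Tree = arrowsF (suc n) τo o

  Hole : Ty
  Hole = Tree ⇒ Tree

  BT≡Tree : BT n ≡ Tree
  BT≡Tree = arrows≡arrowsF n (o ⇒ o ⇒ o) o o

  ⌜_⌝ : BinTree (Fin n) → Term
  ⌜ T ⌝ = enc n o T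

  ⌜⌝≡lamsF : ∀ T → ⌜ T ⌝ ≡ lamsF (suc n) τo (hat T)
  ⌜⌝≡lamsF T = lams-lam≡lamsF n (o ⇒ o ⇒ o) o (hat T)

  ⊢⌜⌝ : ∀ {Γ} T → Γ ⊢ ⌜ T ⌝ ∶ Tree
  ⊢⌜⌝ T rewrite ⌜⌝≡lamsF T = weaken-[] (⊢lamsF (suc n) τo (⊢hat T))

  ⌜⌝-closed : ∀ T → Closed ⌜ T ⌝
  ⌜⌝-closed T = ⊢⇒Closed (⊢⌜⌝ T)

  ⌜⌝-vars : ∀ T → appsF ⌜ T ⌝ (suc n) var =β hat T
  ⌜⌝-vars T rewrite ⌜⌝≡lamsF T = appsF-lamsF-vars (suc n) τo (hat T) (Scoped-hat T)

  -- nodeTm a = λ t u f₀ … x. f_a (t f₀ … x) (u f₀ … x); in nodeBody, t and u are the indices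
  -- suc n + 1 and suc n + 0.
  nodeBody : Fin n → Term
  nodeBody a = app (app (var (suc (n ∸ suc (toℕ a))))
                        (appsF (var (suc n + 1)) (suc n) var))
                   (appsF (var (suc n + 0)) (suc n) var)

  nodeTm : Fin n → Term
  nodeTm a = lamsF 2 (const Tree) (lamsF (suc n) τo (nodeBody a))

  ⊢nodeTm : ∀ {Γ} a → Γ ⊢ nodeTm a ∶ Tree ⇒ Tree ⇒ Tree
  ⊢nodeTm a = weaken-[] (⊢lamsF 2 (const Tree) (⊢lamsF (suc n) τo
     (⊢app (⊢app (⊢var (∋-extendF (suc n) τo (label< a))) (⊢applied 1 (n<1+n 1))) (⊢applied 0 z<s))))
    where
      ⊢applied : ∀ h → h < 2 → extendF (suc n) τo (extendF 2 (const Tree) []) ⊢ appsF (var (suc n + h)) (suc n) var ∶ o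
      ⊢applied h h<2 = ⊢appsF (suc n) τo var (⊢var (∋-extendF-outer (suc n) τo (∋-extendF 2 (const Tree) h<2)))
                              (λ i p → ⊢var (∋-extendF (suc n) τo p))

  nodeTm-closed : ∀ a → Closed (nodeTm a)
  nodeTm-closed a = ⊢⇒Closed (⊢nodeTm a)

  nodeTm-β : ∀ a T U → app (app (nodeTm a) ⌜ T ⌝) ⌜ U ⌝ =β ⌜ node a T U ⌝
  nodeTm-β a T U = begin
    appsF (nodeTm a) 2 g
      ≈⟨ appsF-lamsF-β 2 (const Tree) (lamsF (suc n) τo (nodeBody a)) g (nodeTm-closed a) (args₂-closed (⌜⌝-closed T) (⌜⌝-closed U)) ⟩
    psub 0 g (lamsF (suc n) τo (nodeBody a))
      ≡⟨ psub-lamsF 0 g (suc n) τo (nodeBody a) ⟩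
    lamsF (suc n) τo (psub (suc n) g (nodeBody a))
      ≡⟨ cong (lamsF (suc n) τo) (cong₂ app (cong₂ app (psub-var-< g (label< a)) (psub-appsF-vars (suc n) g 1))
                                             (psub-appsF-vars (suc n) g 0)) ⟩
    lamsF (suc n) τo (app (app (var (suc (n ∸ suc (toℕ a)))) (appsF ⌜ T ⌝ (suc n) var)) (appsF ⌜ U ⌝ (suc n) var))
      ≈⟨ lamsF-cong (suc n) τo (app-cong (app-congʳ (⌜⌝-vars T)) (⌜⌝-vars U)) ⟩
    lamsF (suc n) τo (hat (node a T U))
      ≡⟨ P.sym (⌜⌝≡lamsF (node a T U)) ⟩
    ⌜ node a T U ⌝ ∎
    where
      open =β-Reasoning
      g = args₂ ⌜ T ⌝ ⌜ U ⌝

  plugTm : ∂BinTree (Fin n) → Term → Term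
  plugTm □ u = u
  plugTm (nodeL a C T) u = app (app (nodeTm a) (plugTm C u)) ⌜ T ⌝
  plugTm (nodeR a T C) u = app (app (nodeTm a) ⌜ T ⌝) (plugTm C u)

  ⌜_⌝∂ : ∂BinTree (Fin n) → Term
  ⌜ C ⌝∂ = lam Tree (plugTm C (var 0))

  ⊢plugTm : ∀ {Γ} C u → Γ ⊢ u ∶ Tree → Γ ⊢ plugTm C u ∶ Tree
  ⊢plugTm □ u d = d
  ⊢plugTm (nodeL a C T) u d = ⊢app (⊢app (⊢nodeTm a) (⊢plugTm C u d)) (⊢⌜⌝ T)
  ⊢plugTm (nodeR a T C) u d = ⊢app (⊢app (⊢nodeTm a) (⊢⌜⌝ T)) (⊢plugTm C u d)

  ⊢⌜⌝∂ : ∀ {Γ} C → Γ ⊢ ⌜ C ⌝∂ ∶ Hole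
  ⊢⌜⌝∂ C = weaken-[] (⊢lam (⊢plugTm C (var 0) (⊢var here)))

  ⌜⌝∂-closed : ∀ C → Closed ⌜ C ⌝∂
  ⌜⌝∂-closed C = ⊢⇒Closed (⊢⌜⌝∂ C)

  subst-plugTm : ∀ j s C u → subst j s (plugTm C u) ≡ plugTm C (subst j s u)
  subst-plugTm j s □ u = P.refl
  subst-plugTm j s (nodeL a C T) u =
    cong₂ app (cong₂ app (subst-closed s (nodeTm a) (nodeTm-closed a)) (subst-plugTm j s C u)) (subst-closed s ⌜ T ⌝ (⌜⌝-closed T))
  subst-plugTm j s (nodeR a T C) u =
    cong₂ app (cong₂ app (subst-closed s (nodeTm a) (nodeTm-closed a)) (subst-closed s ⌜ T ⌝ (⌜⌝-closed T))) (subst-plugTm j s C u)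

  ⌜⌝∂-β : ∀ C u → app ⌜ C ⌝∂ u =β plugTm C u
  ⌜⌝∂-β C u = trans (step β) (≡⇒=β (subst-plugTm 0 u C (var 0)))

  plugTm-⌜⌝ : ∀ C U → plugTm C ⌜ U ⌝ =β ⌜ plug C U ⌝
  plugTm-⌜⌝ □ U = refl
  plugTm-⌜⌝ (nodeL a C T) U = trans (app-congˡ (app-congʳ (plugTm-⌜⌝ C U))) (nodeTm-β a (plug C U) T)
  plugTm-⌜⌝ (nodeR a T C) U = trans (app-congʳ (plugTm-⌜⌝ C U)) (nodeTm-β a T (plug C U))

  plugTm-plugTm : ∀ C D u → plugTm C (plugTm D u) ≡ plugTm (plug∂ C D) u
  plugTm-plugTm □ D u = P.refl
  plugTm-plugTm (nodeL a C T) D u = cong (λ z → app (app (nodeTm a) z) ⌜ T ⌝) (plugTm-plugTm C D u)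
  plugTm-plugTm (nodeR a T C) D u = cong (app (app (nodeTm a) ⌜ T ⌝)) (plugTm-plugTm C D u)

  nodeLTm : Fin n → Term
  nodeLTm a = lamsF 2 (encFamily Tree Hole) (lam Tree (app (app (nodeTm a) (app (var 2) (var 0))) (var 1)))

  nodeRTm : Fin n → Term
  nodeRTm a = lamsF 2 (encFamily Hole Tree) (lam Tree (app (app (nodeTm a) (var 2)) (app (var 1) (var 0))))

  compTm : Term
  compTm = lamsF 2 (const Hole) (lam Tree (app (var 2) (app (var 1) (var 0))))

  ⊢nodeLTm : ∀ {Γ} a → Γ ⊢ nodeLTm a ∶ Hole ⇒ Tree ⇒ Hole
  ⊢nodeLTm a = weaken-[] (⊢lam (⊢lam (⊢lam
    (⊢app (⊢app (⊢nodeTm a) (⊢app (⊢var (there (there here))) (⊢var here))) (⊢var (there here))))))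

  ⊢nodeRTm : ∀ {Γ} a → Γ ⊢ nodeRTm a ∶ Tree ⇒ Hole ⇒ Hole
  ⊢nodeRTm a = weaken-[] (⊢lam (⊢lam (⊢lam
    (⊢app (⊢app (⊢nodeTm a) (⊢var (there (there here)))) (⊢app (⊢var (there here)) (⊢var here))))))

  ⊢compTm : ∀ {Γ} → Γ ⊢ compTm ∶ Hole ⇒ Hole ⇒ Hole
  ⊢compTm = weaken-[] (⊢lam (⊢lam (⊢lam (⊢app (⊢var (there (there here))) (⊢app (⊢var (there here)) (⊢var here))))))

  nodeLTm-β : ∀ a C U → app (app (nodeLTm a) ⌜ C ⌝∂) ⌜ U ⌝ =β ⌜ nodeL a C U ⌝∂
  nodeLTm-β a C U = begin
    appsF (nodeLTm a) 2 g
      ≈⟨ appsF-lamsF-β 2 (encFamily Tree Hole) _ g (⊢⇒Closed (⊢nodeLTm a)) (args₂-closed (⌜⌝∂-closed C) (⌜⌝-closed U)) ⟩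
    lam Tree (app (app (psub 1 g (nodeTm a)) (app ⌜ C ⌝∂ (var 0))) ⌜ U ⌝)
      ≡⟨ cong (λ z → lam Tree (app (app z (app ⌜ C ⌝∂ (var 0))) ⌜ U ⌝)) (psub-closed g (nodeTm a) (nodeTm-closed a)) ⟩
    lam Tree (app (app (nodeTm a) (app ⌜ C ⌝∂ (var 0))) ⌜ U ⌝)
      ≈⟨ lam-cong (app-congˡ (app-congʳ (⌜⌝∂-β C (var 0)))) ⟩
    ⌜ nodeL a C U ⌝∂ ∎
    where
      open =β-Reasoning
      g = args₂ ⌜ C ⌝∂ ⌜ U ⌝

  nodeRTm-β : ∀ a U C → app (app (nodeRTm a) ⌜ U ⌝) ⌜ C ⌝∂ =β ⌜ nodeR a U C ⌝∂
  nodeRTm-β a U C = begin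
    appsF (nodeRTm a) 2 g
      ≈⟨ appsF-lamsF-β 2 (encFamily Hole Tree) _ g (⊢⇒Closed (⊢nodeRTm a)) (args₂-closed (⌜⌝-closed U) (⌜⌝∂-closed C)) ⟩
    lam Tree (app (app (psub 1 g (nodeTm a)) ⌜ U ⌝) (app ⌜ C ⌝∂ (var 0)))
      ≡⟨ cong (λ z → lam Tree (app (app z ⌜ U ⌝) (app ⌜ C ⌝∂ (var 0)))) (psub-closed g (nodeTm a) (nodeTm-closed a)) ⟩
    lam Tree (app (app (nodeTm a) ⌜ U ⌝) (app ⌜ C ⌝∂ (var 0)))
      ≈⟨ lam-cong (app-congʳ (⌜⌝∂-β C (var 0))) ⟩
    ⌜ nodeR a U C ⌝∂ ∎
    where
      open =β-Reasoning
      g = args₂ ⌜ U ⌝ ⌜ C ⌝∂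

  compTm-β : ∀ C D → app (app compTm ⌜ C ⌝∂) ⌜ D ⌝∂ =β ⌜ plug∂ C D ⌝∂
  compTm-β C D = begin
    appsF compTm 2 g
      ≈⟨ appsF-lamsF-β 2 (const Hole) _ g (⊢⇒Closed ⊢compTm) (args₂-closed (⌜⌝∂-closed C) (⌜⌝∂-closed D)) ⟩
    lam Tree (app ⌜ C ⌝∂ (app ⌜ D ⌝∂ (var 0)))
      ≈⟨ lam-cong (app-congʳ (⌜⌝∂-β D (var 0))) ⟩
    lam Tree (app ⌜ C ⌝∂ (plugTm D (var 0)))
      ≈⟨ lam-cong (⌜⌝∂-β C (plugTm D (var 0))) ⟩
    lam Tree (plugTm C (plugTm D (var 0)))
      ≡⟨ cong (lam Tree) (plugTm-plugTm C D (var 0)) ⟩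
    ⌜ plug∂ C D ⌝∂ ∎
    where
      open =β-Reasoning
      g = args₂ ⌜ C ⌝∂ ⌜ D ⌝∂

  module _ {V V' : Set} (ρ : V → Term) (ρ' : V' → Term) where
    mutual
      compile : ExprBT (Fin n) V V' → Term
      compile ⟨⟩ = ⌜ ⟨⟩ ⌝
      compile (var x) = ρ x
      compile (node a E F) = app (app (nodeTm a) (compile E)) (compile F)
      compile (plugE E' E) = app (compile∂ E') (compile E)

      compile∂ : Expr∂BT (Fin n) V V' → Term
      compile∂ □ = ⌜ □ ⌝∂
      compile∂ (var' x) = ρ' x
      compile∂ (nodeL a E' E) = app (app (nodeLTm a) (compile∂ E')) (compile E)
      compile∂ (nodeR a E E') = app (app (nodeRTm a) (compile E)) (compile∂ E')
      compile∂ (plug∂E E' F') = app (app compTm (compile∂ E')) (compile∂ F')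

  module _ {V V' : Set} {Γ : Ctx} {ρ : V → Term} {ρ' : V' → Term}
           (⊢ρ : ∀ x → Γ ⊢ ρ x ∶ Tree) (⊢ρ' : ∀ x → Γ ⊢ ρ' x ∶ Hole) where
    mutual
      ⊢compile : ∀ E → Γ ⊢ compile ρ ρ' E ∶ Tree
      ⊢compile ⟨⟩ = ⊢⌜⌝ ⟨⟩
      ⊢compile (var x) = ⊢ρ x
      ⊢compile (node a E F) = ⊢app (⊢app (⊢nodeTm a) (⊢compile E)) (⊢compile F)
      ⊢compile (plugE E' E) = ⊢app (⊢compile∂ E') (⊢compile E)

      ⊢compile∂ : ∀ E' → Γ ⊢ compile∂ ρ ρ' E' ∶ Hole
      ⊢compile∂ □ = ⊢⌜⌝∂ □
      ⊢compile∂ (var' x) = ⊢ρ' x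
      ⊢compile∂ (nodeL a E' E) = ⊢app (⊢app (⊢nodeLTm a) (⊢compile∂ E')) (⊢compile E)
      ⊢compile∂ (nodeR a E E') = ⊢app (⊢app (⊢nodeRTm a) (⊢compile E)) (⊢compile∂ E')
      ⊢compile∂ (plug∂E E' F') = ⊢app (⊢app ⊢compTm (⊢compile∂ E')) (⊢compile∂ F')

  module _ {V V' : Set} (ρ : V → Term) (ρ' : V' → Term) (d : ℕ) (g : ℕ → Term) where
    private
      psub-closed-⊢ : ∀ {t A} → [] ⊢ t ∶ A → psub d g t ≡ t
      psub-closed-⊢ {t} ⊢t = psub-closed g t (⊢⇒Closed ⊢t)
    mutual
      psub-compile : ∀ E → psub d g (compile ρ ρ' E) ≡ compile (λ x → psub d g (ρ x)) (λ x → psub d g (ρ' x)) E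
      psub-compile ⟨⟩ = psub-closed-⊢ (⊢⌜⌝ ⟨⟩)
      psub-compile (var x) = P.refl
      psub-compile (node a E F) = cong₂ app (cong₂ app (psub-closed-⊢ (⊢nodeTm a)) (psub-compile E)) (psub-compile F)
      psub-compile (plugE E' E) = cong₂ app (psub-compile∂ E') (psub-compile E)

      psub-compile∂ : ∀ E' → psub d g (compile∂ ρ ρ' E') ≡ compile∂ (λ x → psub d g (ρ x)) (λ x → psub d g (ρ' x)) E'
      psub-compile∂ □ = psub-closed-⊢ (⊢⌜⌝∂ □)
      psub-compile∂ (var' x) = P.refl
      psub-compile∂ (nodeL a E' E) = cong₂ app (cong₂ app (psub-closed-⊢ (⊢nodeLTm a)) (psub-compile∂ E')) (psub-compile E)
      psub-compile∂ (nodeR a E E') = cong₂ app (cong₂ app (psub-closed-⊢ (⊢nodeRTm a)) (psub-compile E)) (psub-compile∂ E')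
      psub-compile∂ (plug∂E E' F') = cong₂ app (cong₂ app (psub-closed-⊢ ⊢compTm) (psub-compile∂ E')) (psub-compile∂ F')

  module _ {V V' : Set} {ρ : V → Term} {ρ' : V' → Term} {σ : V → BinTree (Fin n)} {σ' : V' → ∂BinTree (Fin n)}
           (ρ≈σ : ∀ x → ρ x =β ⌜ σ x ⌝) (ρ'≈σ' : ∀ x → ρ' x =β ⌜ σ' x ⌝∂) where
    mutual
      compile-correct : ∀ E → compile ρ ρ' E =β ⌜ evalE σ σ' E ⌝
      compile-correct ⟨⟩ = refl
      compile-correct (var x) = ρ≈σ x
      compile-correct (node a E F) = trans (app-cong (app-congʳ (compile-correct E)) (compile-correct F)) (nodeTm-β a _ _)
      compile-correct (plugE E' E) =
        trans (app-cong (compile∂-correct E') (compile-correct E))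
              (trans (⌜⌝∂-β (evalE∂ σ σ' E') _) (plugTm-⌜⌝ (evalE∂ σ σ' E') _))

      compile∂-correct : ∀ E' → compile∂ ρ ρ' E' =β ⌜ evalE∂ σ σ' E' ⌝∂
      compile∂-correct □ = refl
      compile∂-correct (var' x) = ρ'≈σ' x
      compile∂-correct (nodeL a E' E) =
        trans (app-cong (app-congʳ (compile∂-correct E')) (compile-correct E)) (nodeLTm-β a _ _)
      compile∂-correct (nodeR a E E') =
        trans (app-cong (app-congʳ (compile-correct E)) (compile∂-correct E')) (nodeRTm-β a _ _)
      compile∂-correct (plug∂E E' F') =
        trans (app-cong (app-congʳ (compile∂-correct E')) (compile∂-correct F')) (compTm-β _ _)

module Simulation {m n : ℕ} (M : RTT m n) where
  open OutputTrees n
  open RTT M renaming (step to stepConfig)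
  open Config

  Regs : ℕ
  Regs = r' + r

  regTy : ℕ → Ty
  regTy = joinTy r' Hole Tree

  Kont : Ty
  Kont = arrowsF Regs regTy Tree

  Conf : Ty
  Conf = arrowsF k (const Kont) Tree

  regArgs : (Fin r' → Term) → (Fin r → Term) → ℕ → Term
  regArgs ρ' ρ = joinEnv r' (fromFin ρ') (fromFin ρ)

  reg< : (x : Fin r) → r' + toℕ x < Regs
  reg< x = +-monoʳ-< r' (toℕ<n x)

  hole< : (x : Fin r') → toℕ x < Regs
  hole< x = <-≤-trans (toℕ<n x) (m≤m+n r' r)

  regArgs-hole : ∀ ρ' ρ x → regArgs ρ' ρ (toℕ x) ≡ ρ' x
  regArgs-hole ρ' ρ x = P.trans (joinEnv-< r' (fromFin ρ') (fromFin ρ) (toℕ<n x)) (fromFin-toℕ ρ' x)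

  regArgs-reg : ∀ ρ' ρ x → regArgs ρ' ρ (r' + toℕ x) ≡ ρ x
  regArgs-reg ρ' ρ x = P.trans (joinEnv-+ r' (fromFin ρ') (fromFin ρ) (toℕ x)) (fromFin-toℕ ρ x)

  ⊢regArgs : ∀ {Γ ρ' ρ} → (∀ x → Γ ⊢ ρ' x ∶ Hole) → (∀ x → Γ ⊢ ρ x ∶ Tree) →
             ∀ i → i < Regs → Γ ⊢ regArgs ρ' ρ i ∶ regTy i
  ⊢regArgs ⊢ρ' ⊢ρ = ⊢joinEnv r' r Hole Tree _ _ (⊢fromFin _ ⊢ρ') (⊢fromFin _ ⊢ρ)

  psub-regArgs : ∀ d g ρ' ρ i → psub d g (regArgs ρ' ρ i) ≡ regArgs (λ x → psub d g (ρ' x)) (λ x → psub d g (ρ x)) i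
  psub-regArgs d g ρ' ρ i with i <ᵇ r'
  ... | true = fromFin-map (psub d g) ρ' (psub-closed {d} g junk z<s) i
  ... | false = fromFin-map (psub d g) ρ (psub-closed {d} g junk z<s) (i ∸ r')

  regArgs-=β : ∀ {ρ' ρ σ' σ} → (∀ x → ρ' x =β σ' x) → (∀ x → ρ x =β σ x) → ∀ i → regArgs ρ' ρ i =β regArgs σ' σ i
  regArgs-=β ρ'≈σ' ρ≈σ = joinEnv-=β r' _ _ _ _ (fromFin-=β _ _ ρ'≈σ') (fromFin-=β _ _ ρ≈σ)

  configArgs : Config → ℕ → Term
  configArgs c = regArgs (λ x → ⌜ val' c x ⌝∂) (λ x → ⌜ val c x ⌝)

  configArgs-reg : ∀ c x → configArgs c (r' + toℕ x) ≡ ⌜ val c x ⌝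
  configArgs-reg c x = regArgs-reg (λ y → ⌜ val' c y ⌝∂) (λ y → ⌜ val c y ⌝) x

  configArgs-hole : ∀ c x → configArgs c (toℕ x) ≡ ⌜ val' c x ⌝∂
  configArgs-hole c x = regArgs-hole (λ y → ⌜ val' c y ⌝∂) (λ y → ⌜ val c y ⌝) x

  configArgs-closed : ∀ c → ClosedEnv (configArgs c)
  configArgs-closed c =
    joinEnv-closed r' (fromFin (λ x → ⌜ val' c x ⌝∂)) (fromFin (λ x → ⌜ val c x ⌝))
      (fromFin-closed (λ x → ⌜ val' c x ⌝∂) (λ x → ⌜⌝∂-closed (val' c x)))
      (fromFin-closed (λ x → ⌜ val c x ⌝) (λ x → ⌜⌝-closed (val c x)))

  ⊢configArgs : ∀ {Γ} c → ∀ i → i < Regs → Γ ⊢ configArgs c i ∶ regTy i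
  ⊢configArgs c = ⊢regArgs (λ x → ⊢⌜⌝∂ (val' c x)) (λ x → ⊢⌜⌝ (val c x))

  resume : (ℕ → Term) → Config → Term
  resume h c = appsF (h (toℕ (state c))) Regs (configArgs c)

  _encodes_ : Term → Config → Set
  t encodes c = ∀ h → ClosedEnv h → appsF t k h =β resume h c

  leafBody : Term
  leafBody = appsF (var (toℕ qI)) Regs (configArgs (run ⟨⟩))

  leafTm : Term
  leafTm = lamsF k (const Kont) leafBody

  ⊢leafBody : extendF k (const Kont) [] ⊢ leafBody ∶ Tree
  ⊢leafBody = ⊢appsF Regs regTy _ (⊢var (∋-extendF k (const Kont) (toℕ<n qI))) (⊢configArgs (run ⟨⟩))

  ⊢leafTm : ∀ {Γ} → Γ ⊢ leafTm ∶ Conf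
  ⊢leafTm = weaken-[] (⊢lamsF k (const Kont) ⊢leafBody)

  leafTm-encodes : leafTm encodes run ⟨⟩
  leafTm-encodes h ch = begin
    appsF leafTm k h
      ≈⟨ appsF-lamsF-β k (const Kont) leafBody h (⊢⇒Scoped-extendF-[] k (const Kont) ⊢leafBody) ch ⟩
    psub 0 h leafBody
      ≡⟨ psub-appsF 0 h (var (toℕ qI)) Regs (configArgs (run ⟨⟩)) ⟩
    appsF (h (toℕ qI)) Regs (λ i → psub 0 h (configArgs (run ⟨⟩) i))
      ≡⟨ appsF-ext _ Regs _ _ (λ i _ → psub-closed h _ (configArgs-closed (run ⟨⟩) i)) ⟩
    resume h (run ⟨⟩) ∎
    where open =β-Reasoning

  τStep : ℕ → Ty
  τStep = joinTy k Kont Conf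

  -- In the body of stepTm the registers of the right child are bound innermost, those of
  -- the left child right above them.
  updVar : Fin r × Side → Term
  updVar (x , ◁) = var (Regs + (r' + toℕ x))
  updVar (x , ▷) = var (r' + toℕ x)

  updVar' : Fin r' × Side → Term
  updVar' (x , ◁) = var (Regs + toℕ x)
  updVar' (x , ▷) = var (toℕ x)

  updArgs : Fin m → Fin k → Fin k → ℕ → Term
  updArgs a q₁ q₂ = regArgs (λ y → compile∂ updVar updVar' (proj₂ (proj₂ (δ q₁ q₂ a)) y))
                            (λ y → compile updVar updVar' (proj₁ (proj₂ (δ q₁ q₂ a)) y))

  rightBody : Fin m → Fin k → Fin k → Term
  rightBody a q₁ q₂ = appsF (var (Regs + (Regs + toℕ (proj₁ (δ q₁ q₂ a))))) Regs (updArgs a q₁ q₂)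

  rightKont : Fin m → Fin k → Fin k → Term
  rightKont a q₁ q₂ = lamsF Regs regTy (rightBody a q₁ q₂)

  leftBody : Fin m → Fin k → Term
  leftBody a q₁ = appsF (var (Regs + k)) k (fromFin (rightKont a q₁))

  leftKont : Fin m → Fin k → Term
  leftKont a q₁ = lamsF Regs regTy (leftBody a q₁)

  stepBody : Fin m → Term
  stepBody a = appsF (var (suc k)) k (fromFin (leftKont a))

  stepTm : Fin m → Term
  stepTm a = lamsF (2 + k) τStep (stepBody a)

  Γ₀ Γ₁ Γ₂ : Ctx
  Γ₀ = extendF (2 + k) τStep []
  Γ₁ = extendF Regs regTy Γ₀
  Γ₂ = extendF Regs regTy Γ₁

  ⊢reg : ∀ {Γ} x → extendF Regs regTy Γ ∋ r' + toℕ x ∶ Tree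
  ⊢reg x = ∋-extendF-≡ Regs regTy (reg< x) (joinTy-≥ r' Hole Tree (m≤m+n r' (toℕ x)))

  ⊢hole : ∀ {Γ} x → extendF Regs regTy Γ ∋ toℕ x ∶ Hole
  ⊢hole x = ∋-extendF-≡ Regs regTy (hole< x) (joinTy-< r' Hole Tree (toℕ<n x))

  ⊢updVar : ∀ v → Γ₂ ⊢ updVar v ∶ Tree
  ⊢updVar (x , ◁) = ⊢var (∋-extendF-outer Regs regTy (⊢reg x))
  ⊢updVar (x , ▷) = ⊢var (⊢reg x)

  ⊢updVar' : ∀ v → Γ₂ ⊢ updVar' v ∶ Hole
  ⊢updVar' (x , ◁) = ⊢var (∋-extendF-outer Regs regTy (⊢hole x))
  ⊢updVar' (x , ▷) = ⊢var (⊢hole x)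

  ⊢rightBody : ∀ a q₁ q₂ → Γ₂ ⊢ rightBody a q₁ q₂ ∶ Tree
  ⊢rightBody a q₁ q₂ =
    ⊢appsF Regs regTy _
      (⊢var (∋-extendF-outer Regs regTy (∋-extendF-outer Regs regTy
        (∋-extendF-≡ (2 + k) τStep (<-≤-trans (toℕ<n q) (m≤n+m k 2)) (joinTy-< k Kont Conf (toℕ<n q))))))
      (⊢regArgs (λ y → ⊢compile∂ ⊢updVar ⊢updVar' (proj₂ (proj₂ (δ q₁ q₂ a)) y))
                (λ y → ⊢compile ⊢updVar ⊢updVar' (proj₁ (proj₂ (δ q₁ q₂ a)) y)))
    where q = proj₁ (δ q₁ q₂ a)

  ⊢leftBody : ∀ a q₁ → Γ₁ ⊢ leftBody a q₁ ∶ Tree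
  ⊢leftBody a q₁ =
    ⊢appsF k (const Kont) _
      (⊢var (∋-extendF-outer Regs regTy (∋-extendF-≡ (2 + k) τStep (n≤1+n (suc k)) (joinTy-≥ k Kont Conf ≤-refl))))
      (⊢fromFin _ (λ q₂ → ⊢lamsF Regs regTy (⊢rightBody a q₁ q₂)))

  ⊢stepBody : ∀ a → Γ₀ ⊢ stepBody a ∶ Tree
  ⊢stepBody a =
    ⊢appsF k (const Kont) _
      (⊢var (∋-extendF-≡ (2 + k) τStep ≤-refl (joinTy-≥ k Kont Conf (n≤1+n k))))
      (⊢fromFin _ (λ q₁ → ⊢lamsF Regs regTy (⊢leftBody a q₁)))

  ⊢stepTm : ∀ {Γ} a → Γ ⊢ stepTm a ∶ Conf ⇒ Conf ⇒ Conf
  ⊢stepTm a = weaken-[] (P.subst (λ X → [] ⊢ stepTm a ∶ X) τStep-arrows (⊢lamsF (2 + k) τStep (⊢stepBody a)))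
    where
      τStep-arrows : arrowsF (2 + k) τStep Tree ≡ Conf ⇒ Conf ⇒ Conf
      τStep-arrows = cong₂ _⇒_ (joinTy-≥ k Kont Conf (n≤1+n k))
                       (cong₂ _⇒_ (joinTy-≥ k Kont Conf ≤-refl)
                                  (arrowsF-ext k τStep (const Kont) Tree (λ i → joinTy-< k Kont Conf)))

  module _ (c₁ c₂ : Config) (g : ℕ → Term) where
    private
      inner env : ℕ → Term
      inner = joinEnv Regs (configArgs c₁) g
      env = joinEnv Regs (configArgs c₂) inner

    updVar-lookup : ∀ v → psub 0 env (updVar v) ≡ ⌜ joinSides (val c₁) (val c₂) v ⌝
    updVar-lookup (x , ◁) =
      P.trans (joinEnv-+ Regs (configArgs c₂) inner (r' + toℕ x))
      (P.trans (joinEnv-< Regs (configArgs c₁) g (reg< x)) (configArgs-reg c₁ x))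
    updVar-lookup (x , ▷) = P.trans (joinEnv-< Regs (configArgs c₂) inner (reg< x)) (configArgs-reg c₂ x)

    updVar'-lookup : ∀ v → psub 0 env (updVar' v) ≡ ⌜ joinSides (val' c₁) (val' c₂) v ⌝∂
    updVar'-lookup (x , ◁) =
      P.trans (joinEnv-+ Regs (configArgs c₂) inner (toℕ x))
      (P.trans (joinEnv-< Regs (configArgs c₁) g (hole< x)) (configArgs-hole c₁ x))
    updVar'-lookup (x , ▷) = P.trans (joinEnv-< Regs (configArgs c₂) inner (hole< x)) (configArgs-hole c₂ x)

    updArgs-correct : ∀ a i → psub 0 env (updArgs a (state c₁) (state c₂) i) =β configArgs (stepConfig a c₁ c₂) i
    updArgs-correct a i = trans (≡⇒=β (psub-regArgs 0 env _ _ i)) (regArgs-=β hole reg i)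
      where
        upd = proj₂ (δ (state c₁) (state c₂) a)
        ρ≈ = λ v → ≡⇒=β (updVar-lookup v)
        ρ'≈ = λ v → ≡⇒=β (updVar'-lookup v)
        hole : ∀ y → psub 0 env (compile∂ updVar updVar' (proj₂ upd y)) =β ⌜ val' (stepConfig a c₁ c₂) y ⌝∂
        hole y = trans (≡⇒=β (psub-compile∂ updVar updVar' 0 env (proj₂ upd y))) (compile∂-correct ρ≈ ρ'≈ (proj₂ upd y))
        reg : ∀ y → psub 0 env (compile updVar updVar' (proj₁ upd y)) =β ⌜ val (stepConfig a c₁ c₂) y ⌝
        reg y = trans (≡⇒=β (psub-compile updVar updVar' 0 env (proj₁ upd y))) (compile-correct ρ≈ ρ'≈ (proj₁ upd y))


  module StepReduction (a : Fin m) {t u : Term} {h : ℕ → Term} (ct : Closed t) (cu : Closed u) (ch : ClosedEnv h) where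
    g : ℕ → Term
    g = joinEnv k h (args₂ t u)

    g-closed : ClosedEnv g
    g-closed = joinEnv-closed k h (args₂ t u) ch (args₂-closed ct cu)

    leftKonts : ℕ → Term
    leftKonts i = psub 0 g (fromFin (leftKont a) i)

    leftKonts-closed : ClosedEnv leftKonts
    leftKonts-closed = psub-fromFin-closed g (leftKont a) (λ q₁ → ⊢⇒Scoped (⊢lamsF Regs regTy (⊢leftBody a q₁))) g-closed

    leftEnv : Config → ℕ → Term
    leftEnv c₁ = joinEnv Regs (configArgs c₁) g

    leftEnv-closed : ∀ c₁ → ClosedEnv (leftEnv c₁)
    leftEnv-closed c₁ = joinEnv-closed Regs (configArgs c₁) g (configArgs-closed c₁) g-closed

    rightKonts : Config → ℕ → Term
    rightKonts c₁ i = psub 0 (leftEnv c₁) (fromFin (rightKont a (state c₁)) i)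

    rightKonts-closed : ∀ c₁ → ClosedEnv (rightKonts c₁)
    rightKonts-closed c₁ =
      psub-fromFin-closed (leftEnv c₁) (rightKont a (state c₁))
        (λ q₂ → ⊢⇒Scoped (⊢lamsF Regs regTy (⊢rightBody a (state c₁) q₂))) (leftEnv-closed c₁)

    stepTm-calls-left : appsF (app (app (stepTm a) t) u) k h =β appsF t k leftKonts
    stepTm-calls-left = begin
      appsF (app (app (stepTm a) t) u) k h
        ≡⟨ P.sym (appsF-joinEnv (stepTm a) 2 k h (args₂ t u)) ⟩
      appsF (stepTm a) (2 + k) g
        ≈⟨ appsF-lamsF-β (2 + k) τStep (stepBody a) g (⊢⇒Scoped-extendF-[] (2 + k) τStep (⊢stepBody a)) g-closed ⟩
      psub 0 g (stepBody a)
        ≡⟨ psub-appsF 0 g (var (suc k)) k (fromFin (leftKont a)) ⟩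
      appsF (g (suc k)) k leftKonts
        ≡⟨ cong (λ z → appsF z k leftKonts) (joinEnv-at-suc k h (args₂ t u)) ⟩
      appsF t k leftKonts ∎
      where open =β-Reasoning

    leftKont-calls-right : ∀ c₁ → resume leftKonts c₁ =β appsF u k (rightKonts c₁)
    leftKont-calls-right c₁ = begin
      appsF (leftKonts (toℕ q₁)) Regs (configArgs c₁)
        ≡⟨ cong (λ z → appsF (psub 0 g z) Regs (configArgs c₁)) (fromFin-toℕ (leftKont a) q₁) ⟩
      appsF (psub 0 g (leftKont a q₁)) Regs (configArgs c₁)
        ≈⟨ appsF-psub-lamsF-β Regs regTy _ (leftBody a q₁) g (configArgs c₁)
             (⊢⇒Scoped-extendF Regs regTy (⊢leftBody a q₁)) g-closed (configArgs-closed c₁) ⟩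
      psub 0 (leftEnv c₁) (leftBody a q₁)
        ≡⟨ psub-appsF 0 (leftEnv c₁) (var (Regs + k)) k (fromFin (rightKont a q₁)) ⟩
      appsF (leftEnv c₁ (Regs + k)) k (rightKonts c₁)
        ≡⟨ cong (λ z → appsF z k (rightKonts c₁))
                (P.trans (joinEnv-+ Regs (configArgs c₁) g k) (joinEnv-at k h (args₂ t u))) ⟩
      appsF u k (rightKonts c₁) ∎
      where
        open =β-Reasoning
        q₁ = state c₁

    rightKont-resumes : ∀ c₁ c₂ → resume (rightKonts c₁) c₂ =β resume h (stepConfig a c₁ c₂)
    rightKont-resumes c₁ c₂ = begin
      appsF (rightKonts c₁ (toℕ q₂)) Regs (configArgs c₂)
        ≡⟨ cong (λ z → appsF (psub 0 (leftEnv c₁) z) Regs (configArgs c₂)) (fromFin-toℕ (rightKont a q₁) q₂) ⟩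
      appsF (psub 0 (leftEnv c₁) (rightKont a q₁ q₂)) Regs (configArgs c₂)
        ≈⟨ appsF-psub-lamsF-β Regs regTy _ (rightBody a q₁ q₂) (leftEnv c₁) (configArgs c₂)
             (⊢⇒Scoped-extendF Regs regTy (⊢rightBody a q₁ q₂)) (leftEnv-closed c₁) (configArgs-closed c₂) ⟩
      psub 0 env (rightBody a q₁ q₂)
        ≡⟨ psub-appsF 0 env _ Regs (updArgs a q₁ q₂) ⟩
      appsF (env (Regs + (Regs + toℕ q))) Regs (λ i → psub 0 env (updArgs a q₁ q₂ i))
        ≡⟨ cong (λ z → appsF z Regs (λ i → psub 0 env (updArgs a q₁ q₂ i))) env-state ⟩
      appsF (h (toℕ q)) Regs (λ i → psub 0 env (updArgs a q₁ q₂ i))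
        ≈⟨ appsF-congʳ _ Regs _ _ (λ i _ → updArgs-correct c₁ c₂ g a i) ⟩
      resume h (stepConfig a c₁ c₂) ∎
      where
        open =β-Reasoning
        q₁ = state c₁
        q₂ = state c₂
        q = proj₁ (δ q₁ q₂ a)
        env = joinEnv Regs (configArgs c₂) (leftEnv c₁)
        env-state : env (Regs + (Regs + toℕ q)) ≡ h (toℕ q)
        env-state = P.trans (joinEnv-+ Regs (configArgs c₂) (leftEnv c₁) (Regs + toℕ q))
                    (P.trans (joinEnv-+ Regs (configArgs c₁) g (toℕ q)) (joinEnv-< k h (args₂ t u) (toℕ<n q)))

  stepTm-encodes : ∀ a {t u c₁ c₂} → Closed t → Closed u → t encodes c₁ → u encodes c₂ →
                   app (app (stepTm a) t) u encodes stepConfig a c₁ c₂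
  stepTm-encodes a {t} {u} {c₁} {c₂} ct cu t⇝c₁ u⇝c₂ h ch = begin
    appsF (app (app (stepTm a) t) u) k h  ≈⟨ stepTm-calls-left ⟩
    appsF t k leftKonts                   ≈⟨ t⇝c₁ leftKonts leftKonts-closed ⟩
    resume leftKonts c₁                   ≈⟨ leftKont-calls-right c₁ ⟩
    appsF u k (rightKonts c₁)             ≈⟨ u⇝c₂ (rightKonts c₁) (rightKonts-closed c₁) ⟩
    resume (rightKonts c₁) c₂             ≈⟨ rightKont-resumes c₁ c₂ ⟩
    resume h (stepConfig a c₁ c₂)         ∎
    where
      open =β-Reasoning
      open StepReduction a {t} {u} {h} ct cu ch

  simulate : BinTree (Fin m) → Term
  simulate ⟨⟩ = leafTm
  simulate (node a T U) = app (app (stepTm a) (simulate T)) (simulate U)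

  ⊢simulate : ∀ {Γ} T → Γ ⊢ simulate T ∶ Conf
  ⊢simulate ⟨⟩ = ⊢leafTm
  ⊢simulate (node a T U) = ⊢app (⊢app (⊢stepTm a) (⊢simulate T)) (⊢simulate U)

  simulate-encodes : ∀ T → simulate T encodes run T
  simulate-encodes ⟨⟩ = leafTm-encodes
  simulate-encodes (node a T U) =
    stepTm-encodes a (⊢⇒Closed (⊢simulate T)) (⊢⇒Closed (⊢simulate U)) (simulate-encodes T) (simulate-encodes U)

  outputBody : Fin k → Term
  outputBody q = compile (λ x → var (r' + toℕ x)) (λ x → var (toℕ x)) (F q)

  outputKont : Fin k → Term
  outputKont q = lamsF Regs regTy (outputBody q)

  ⊢outputBody : ∀ q → extendF Regs regTy [] ⊢ outputBody q ∶ Tree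
  ⊢outputBody q = ⊢compile (λ x → ⊢var (⊢reg x)) (λ x → ⊢var (⊢hole x)) (F q)

  ⊢outputKont : ∀ {Γ} q → Γ ⊢ outputKont q ∶ Kont
  ⊢outputKont q = weaken-[] (⊢lamsF Regs regTy (⊢outputBody q))

  outputKont-correct : ∀ c → resume (fromFin outputKont) c =β ⌜ evalE (val c) (val' c) (F (state c)) ⌝
  outputKont-correct c = begin
    appsF (fromFin outputKont (toℕ (state c))) Regs (configArgs c)
      ≡⟨ cong (λ z → appsF z Regs (configArgs c)) (fromFin-toℕ outputKont (state c)) ⟩
    appsF (outputKont (state c)) Regs (configArgs c)
      ≈⟨ appsF-lamsF-β Regs regTy _ (configArgs c) (⊢⇒Scoped-extendF-[] Regs regTy (⊢outputBody (state c))) (configArgs-closed c) ⟩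
    psub 0 (configArgs c) (outputBody (state c))
      ≡⟨ psub-compile _ _ 0 (configArgs c) (F (state c)) ⟩
    compile (λ x → configArgs c (r' + toℕ x)) (λ x → configArgs c (toℕ x)) (F (state c))
      ≈⟨ compile-correct (λ x → ≡⇒=β (configArgs-reg c x)) (λ x → ≡⇒=β (configArgs-hole c x)) (F (state c)) ⟩
    ⌜ evalE (val c) (val' c) (F (state c)) ⌝ ∎
    where open =β-Reasoning

  -- The encoding of the input binds x at index 0 and the letter m ∸ suc i at index suc i (cf. hat).
  inputArgs : ℕ → Term
  inputArgs zero = leafTm
  inputArgs (suc i) = fromFin stepTm (m ∸ suc i)

  inputArgs-closed : ClosedEnv inputArgs
  inputArgs-closed zero = ⊢⇒Closed ⊢leafTm
  inputArgs-closed (suc i) = fromFin-closed stepTm (λ a → ⊢⇒Closed (⊢stepTm a)) (m ∸ suc i)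

  ⊢inputArgs : ∀ {Γ} i → i < suc m → Γ ⊢ inputArgs i ∶ encFamily Conf (Conf ⇒ Conf ⇒ Conf) i
  ⊢inputArgs zero _ = ⊢leafTm
  ⊢inputArgs (suc i) (s<s i<m) = ⊢fromFin stepTm ⊢stepTm (m ∸ suc i) (∸-monoʳ-< z<s i<m)

  psub-inputArgs-hat : ∀ T → psub 0 inputArgs (hat T) ≡ simulate T
  psub-inputArgs-hat ⟨⟩ = P.refl
  psub-inputArgs-hat (node a T U) =
    cong₂ app (cong₂ app (P.trans (cong (fromFin stepTm) (label-inverse a)) (fromFin-toℕ stepTm a))
                         (psub-inputArgs-hat T))
              (psub-inputArgs-hat U)

  enc-inputArgs : ∀ T → appsF (enc m Conf T) (suc m) inputArgs =β simulate T
  enc-inputArgs T = begin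
    appsF (enc m Conf T) (suc m) inputArgs
      ≡⟨ cong (λ z → appsF z (suc m) inputArgs) (lams-lam≡lamsF m (Conf ⇒ Conf ⇒ Conf) Conf (hat T)) ⟩
    appsF (lamsF (suc m) (encFamily Conf (Conf ⇒ Conf ⇒ Conf)) (hat T)) (suc m) inputArgs
      ≈⟨ appsF-lamsF-β (suc m) _ (hat T) inputArgs (Scoped-hat T) inputArgs-closed ⟩
    psub 0 inputArgs (hat T)
      ≡⟨ psub-inputArgs-hat T ⟩
    simulate T ∎
    where open =β-Reasoning

  transducerTm : Term
  transducerTm = lam (BT[ m ] Conf) (appsF (appsF (var 0) (suc m) inputArgs) k (fromFin outputKont))

  ⊢transducerTm : [] ⊢ transducerTm ∶ BT[ m ] Conf ⇒ BT n
  ⊢transducerTm = P.subst (λ X → [] ⊢ transducerTm ∶ BT[ m ] Conf ⇒ X) (P.sym BT≡Tree) (⊢lam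
    (⊢appsF k (const Kont) _
      (⊢appsF (suc m) (encFamily Conf (Conf ⇒ Conf ⇒ Conf)) inputArgs
        (P.subst (λ X → (BT[ m ] Conf ∷ []) ⊢ var 0 ∶ X) (arrows≡arrowsF m (Conf ⇒ Conf ⇒ Conf) Conf Conf) (⊢var here))
        ⊢inputArgs)
      (⊢fromFin outputKont ⊢outputKont)))

  transducerTm-correct : ∀ T → app transducerTm (enc m Conf T) =β ⌜ output T ⌝
  transducerTm-correct T = begin
    app transducerTm (enc m Conf T)
      ≈⟨ step β ⟩
    subst 0 (enc m Conf T) (appsF (appsF (var 0) (suc m) inputArgs) k outs)
      ≡⟨ P.trans (subst-appsF-closed 0 _ _ k outs outs-closed)
                 (cong (λ z → appsF z k outs) (subst-appsF-closed 0 _ (var 0) (suc m) inputArgs inputArgs-closed)) ⟩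
    appsF (appsF (enc m Conf T) (suc m) inputArgs) k outs
      ≈⟨ appsF-congˡ k outs (enc-inputArgs T) ⟩
    appsF (simulate T) k outs
      ≈⟨ simulate-encodes T outs outs-closed ⟩
    resume outs (run T)
      ≈⟨ outputKont-correct (run T) ⟩
    ⌜ output T ⌝ ∎
    where
      open =β-Reasoning
      outs = fromFin outputKont
      outs-closed = fromFin-closed outputKont (λ q → ⊢⇒Closed (⊢outputKont q))

corollary35 : (m n : ℕ) (f : BinTree (Fin m) → BinTree (Fin n)) → Regular f →
    Σ Ty (λ A → Σ Term (λ t →
      ([] ⊢ t ∶ (BT[ m ] A ⇒ BT n)) ×
      ((T : BinTree (Fin m)) → app t (enc m A T) =β enc n o (f T))))
corollary35 m n f (B , output≡f) =
  Conf , transducerTm , ⊢transducerTm ,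
  λ T → trans (transducerTm-correct T) (≡⇒=β (cong (enc n o) (output≡f T)))
  where open Simulation (BRTT.rtt B)
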